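{- Let $\ell\geq1$, $h\geq1$, $1\leq d\leq h$, and let $\mu=(h,1,\dotsc,1)$ be the hook with $\ell+1$ parts. Then the polynomial $B_{\mu,d}(x,1)-x$ in $x$ is unimodal and has no internal zeros.
   Context: For a partition $\mu=(\mu_0\geq\cdots\geq\mu_\ell\geq1)$: an anchor word is a word $a_1\cdots a_n$ over $\{1,\dotsc,d,\infty\}$ such that $a_i\neq\infty$ implies $a_{i+k}\geq a_i+\mu_k$ for $k=1,\dotsc,\ell$ ($\infty$ larger than every integer) and $a_{n-\ell+1}=\cdots=a_n=\infty$. A fault-free anchor word is either $(\infty)$ or a word starting with an integer, ending with $\ell$ consecutive $\infty$'s, with that final block the only occurrence of $\ell$ consecutive $\infty$'s. $B_{\mu,d}(x,t)=\sum x^{\mathrm{width}(w)}t^{\mathrm{bigtiles}(w)}$ over fault-free anchor words $w$, where width is the length and bigtiles the number of non-$\infty$ letters. A polynomial $\sum_i a_ix^i$ with nonnegative coefficients is unimodal if $a_0\leq\cdots\leq a_k\geq a_{k+1}\geq\cdots$ for some $k$; it has no internal zeros if there are no indices $i<j<m$ with $a_i\neq0$, $a_j=0$, $a_m\neq0$. -}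

module Defs where

open import Data.Nat using (ℕ; zero; suc; _+_; _∸_; _≤ᵇ_; _<_; _≤_; _≡ᵇ_)
open import Data.Bool using (Bool; true; false; _∧_; _∨_; not; if_then_else_)
open import Data.Maybe using (Maybe; just; nothing; is-nothing; is-just)
open import Data.List using (List; []; _∷_; map; concatMap; length; take; drop; filter; replicate; upTo)
open import Data.Product using (Σ; _×_)
open import Relation.Binary.PropositionalEquality using (_≡_; _≢_)
open import Relation.Nullary.Decidable using (Dec)
open import Data.Bool.Properties using (T?)
open import Data.Bool using (T)

-- A letter is an element of {1,…,d,∞}: `just v` is the integer v, `nothing` is ∞.
Letter : Set
Letter = Maybe ℕ

Word : Set
Word = List Letter

letters : ℕ → List Letter
letters d = nothing ∷ map (λ i → just (suc i)) (upTo d)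

words : ℕ → ℕ → List Word
words d zero    = [] ∷ []
words d (suc n) = concatMap (λ a → map (a ∷_) (words d n)) (letters d)

geqL : Letter → ℕ → Bool
geqL nothing  t = true
geqL (just u) t = t ≤ᵇ u

okFrom : ℕ → List ℕ → Word → Bool
okFrom v (m ∷ ms) (y ∷ ys) = geqL y (v + m) ∧ okFrom v ms ys
okFrom v _        _        = true

-- The constraint a_i ≠ ∞ ⇒ a_{i+k} ≥ a_i + μ_k (k = 1..ℓ), for all i.
anchorCond : List ℕ → Word → Bool
anchorCond ms []             = true
anchorCond ms (nothing ∷ w)  = anchorCond ms w
anchorCond ms (just v ∷ w)   = okFrom v ms w ∧ anchorCond ms w

-- A partition μ = (μ_0 ≥ … ≥ μ_ℓ) is given as the list μ_0 ∷ … ∷ μ_ℓ.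
ℓOf : List ℕ → ℕ
ℓOf μ = length μ ∸ 1

tailParts : List ℕ → List ℕ
tailParts []      = []
tailParts (_ ∷ μ) = μ

allB : {A : Set} → (A → Bool) → List A → Bool
allB p []       = true
allB p (x ∷ xs) = p x ∧ allB p xs

allInf : Word → Bool
allInf w = allB is-nothing w

endsWithInfBlock : ℕ → Word → Bool
endsWithInfBlock ℓ w = (ℓ ≤ᵇ length w) ∧ allInf (drop (length w ∸ ℓ) w)

isAnchor : List ℕ → Word → Bool
isAnchor μ w = anchorCond (tailParts μ) w ∧ endsWithInfBlock (ℓOf μ) w

startsWithInt : Word → Bool
startsWithInt []      = false
startsWithInt (a ∷ _) = is-just a

-- No block of ℓ consecutive ∞'s starting at a position i (0-based) with
-- i < n - ℓ, i.e. other than the final block.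
noEarlyInfBlock : ℕ → Word → Bool
noEarlyInfBlock ℓ w =
  allB (λ i → not (allInf (take ℓ (drop i w)))) (upTo (length w ∸ ℓ))

isSingleInf : Word → Bool
isSingleInf (nothing ∷ []) = true
isSingleInf _              = false

isFaultFree : List ℕ → Word → Bool
isFaultFree μ w =
  isSingleInf w ∨
  (isAnchor μ w ∧ startsWithInt w ∧ noEarlyInfBlock (ℓOf μ) w)

-- Coefficient of x^n in B_{μ,d}(x,1): the number of fault-free anchor words
-- over {1,…,d,∞} of width n.
Bcoeff : List ℕ → ℕ → ℕ → ℕ
Bcoeff μ d n = length (filter (λ w → T? (isFaultFree μ w)) (words d n))

BminusXcoeff : List ℕ → ℕ → ℕ → ℕ
BminusXcoeff μ d n = Bcoeff μ d n ∸ (if n ≡ᵇ 1 then 1 else 0)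

hook : ℕ → ℕ → List ℕ
hook h ℓ = h ∷ replicate ℓ 1

-- Polynomials with ℕ coefficients, given by their coefficient function.
Unimodal : (ℕ → ℕ) → Set
Unimodal a = Σ ℕ λ k → (∀ i → suc i ≤ k → a i ≤ a (suc i))
                     × (∀ i → k ≤ i → a (suc i) ≤ a i)

NoInternalZeros : (ℕ → ℕ) → Set
NoInternalZeros a = ∀ i j m → i < j → j < m → a i ≢ 0 → a m ≢ 0 → a j ≢ 0

{-# OPTIONS --safe #-}

-- For the hook only μ₁ = ⋯ = μ_ℓ = 1 enter the anchor condition, so the fault-free anchor words
-- other than (∞) are exactly v₁ ∞^{g₁} v₂ ⋯ ∞^{g_{r-1}} v_r ∞^ℓ with v₁ < ⋯ < v_r in {1,…,d} and
-- every gap g_i < ℓ (the constraints of v_i beyond v_{i+1} follow from those of v_{i+1}).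
-- Counting them letter by letter gives B_{μ,d}(x,1) − x = x F_d, where F_0 = 0 and
-- F_{k+1} = x^ℓ + (1 + x + ⋯ + x^ℓ) F_k.  Multiplying a unimodal sequence s by 1 + x + ⋯ + x^ℓ
-- keeps it unimodal, because the increments s(n+1) − s(n−ℓ) change sign at most once.  Adding x^ℓ
-- then keeps unimodality, since F_k vanishes below x^ℓ and either has a nonzero coefficient at
-- x^{ℓ+1} (so the product strictly rises at x^ℓ) or is a constant multiple of x^ℓ.  Finally, a
-- unimodal sequence has no internal zeros.

module Submission where

open import Defs
open import Data.Bool using (Bool; true; false; _∧_; _∨_; not; if_then_else_; T)
open import Data.Bool.Properties using (∧-assoc; ∧-zeroʳ; ∧-identityʳ; T-≡; T-∧)
open import Data.List using (List; []; _∷_; _++_; map; concatMap; length; take; drop; filter; replicate; upTo; applyUpTo)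
open import Data.List.Properties using (length-replicate; length-++; ++-identityʳ; map-∘)
open import Data.Maybe using (just; nothing)
open import Data.Nat using (ℕ; zero; suc; _+_; _∸_; _≤_; _<_; _≤′_; ≤′-refl; ≤′-step; _≤ᵇ_; _<ᵇ_; _≡ᵇ_; z≤n; s≤s; z<s; _≤?_; _<?_; _≟_)
open import Data.Nat.Properties
open import Data.Nat.ListAction using (sum)
open import Data.Product using (_×_; _,_; proj₁; proj₂)
open import Data.Sum using (inj₁; inj₂; _⊎_)
open import Function using (_∘_; id; Equivalence)
open import Relation.Binary.PropositionalEquality
open import Relation.Nullary using (¬_; yes; no)
open import Relation.Nullary.Decidable using (dec-true; dec-false; T?)

≤ᵇ-true : ∀ {m n} → m ≤ n → (m ≤ᵇ n) ≡ true
≤ᵇ-true {m} {n} = dec-true (m ≤? n)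

≤ᵇ-false : ∀ {m n} → ¬ m ≤ n → (m ≤ᵇ n) ≡ false
≤ᵇ-false {m} {n} = dec-false (m ≤? n)

<ᵇ-true : ∀ {m n} → m < n → (m <ᵇ n) ≡ true
<ᵇ-true {m} {n} = dec-true (m <? n)

<ᵇ-false : ∀ {m n} → ¬ m < n → (m <ᵇ n) ≡ false
<ᵇ-false {m} {n} = dec-false (m <? n)

≡ᵇ-true : ∀ n → (n ≡ᵇ n) ≡ true
≡ᵇ-true n = dec-true (n ≟ n) refl

≡ᵇ-false : ∀ {m n} → m ≢ n → (m ≡ᵇ n) ≡ false
≡ᵇ-false {m} {n} = dec-false (m ≟ n)

if-true-true : ∀ c → (if c then true else true) ≡ true
if-true-true true  = refl
if-true-true false = refl

∧-redundant : ∀ a b c → (T a → T c → T b) → (a ∧ b) ∧ c ≡ a ∧ c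
∧-redundant false b c     _       = refl
∧-redundant true  b false _       = ∧-zeroʳ b
∧-redundant true  b true  implied = trans (∧-identityʳ b) (Equivalence.to T-≡ (implied _ _))

-- Sequences ℕ → ℕ are coefficient sequences of power series in x.
Seq : Set
Seq = ℕ → ℕ

unimodal-≤-before-peak : ∀ {a : Seq} (U : Unimodal a) {i j} → i ≤ j → j ≤ proj₁ U → a i ≤ a j
unimodal-≤-before-peak {a} (k , rising , _) {i} i≤j = go (≤⇒≤′ i≤j)
  where
  go : ∀ {j} → i ≤′ j → j ≤ k → a i ≤ a j
  go ≤′-refl         _   = ≤-refl
  go (≤′-step i≤′j) j<k = ≤-trans (go i≤′j (<⇒≤ j<k)) (rising _ j<k)

unimodal-≥-after-peak : ∀ {a : Seq} (U : Unimodal a) {i j} → proj₁ U ≤ i → i ≤ j → a j ≤ a i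
unimodal-≥-after-peak {a} (k , _ , falling) {i} k≤i i≤j = go (≤⇒≤′ i≤j)
  where
  go : ∀ {j} → i ≤′ j → a j ≤ a i
  go ≤′-refl         = ≤-refl
  go (≤′-step i≤′j) = ≤-trans (falling _ (≤-trans k≤i (≤′⇒≤ i≤′j))) (go i≤′j)

unimodal⇒noInternalZeros : ∀ {a : Seq} → Unimodal a → NoInternalZeros a
unimodal⇒noInternalZeros {a} U i j m i<j j<m aᵢ≢0 aₘ≢0 aⱼ≡0 with j ≤? proj₁ U
... | yes j≤k = aᵢ≢0 (n≤0⇒n≡0 (subst (a i ≤_) aⱼ≡0 (unimodal-≤-before-peak U (<⇒≤ i<j) j≤k)))
... | no  j≰k = aₘ≢0 (n≤0⇒n≡0 (subst (a m ≤_) aⱼ≡0 (unimodal-≥-after-peak U (<⇒≤ (≰⇒> j≰k)) (<⇒≤ j<m))))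

-- Walk down from B while a does not increase: the first ascent met is a peak, since a descent
-- below it would persist up to it.
unimodal-if-descents-persist : ∀ {a : Seq} B →
  (∀ i → B ≤ i → a (suc i) ≤ a i) →
  (∀ i j → i ≤ j → a (suc i) < a i → a (suc j) ≤ a j) →
  Unimodal a
unimodal-if-descents-persist zero    eventually _ = 0 , (λ _ ()) , eventually
unimodal-if-descents-persist {a} (suc B) eventually persist with a (suc B) ≤? a B
... | yes descent = unimodal-if-descents-persist B eventually′ persist
  where
  eventually′ : ∀ i → B ≤ i → a (suc i) ≤ a i
  eventually′ i B≤i with m≤n⇒m<n∨m≡n B≤i
  ... | inj₁ B<i  = eventually i B<i
  ... | inj₂ refl = descent
... | no ascent = suc B , rising , eventually
  where
  rising : ∀ i → suc i ≤ suc B → a i ≤ a (suc i)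
  rising i (s≤s i≤B) = ≮⇒≥ (λ descent → ascent (persist i B i≤B descent))

unimodal-shift : ∀ {a s : Seq} → a 0 ≡ 0 → (∀ n → a (suc n) ≡ s n) → Unimodal s → Unimodal a
unimodal-shift {a} a₀≡0 a₁₊≡s (k , rising , falling) = suc k , rising′ , falling′
  where
  rising′ : ∀ i → suc i ≤ suc k → a i ≤ a (suc i)
  rising′ zero    _          = subst (_≤ a 1) (sym a₀≡0) z≤n
  rising′ (suc i) (s≤s i<k) = subst₂ _≤_ (sym (a₁₊≡s i)) (sym (a₁₊≡s (suc i))) (rising i i<k)
  falling′ : ∀ i → suc k ≤ i → a (suc i) ≤ a i
  falling′ (suc i) (s≤s k≤i) = subst₂ _≤_ (sym (a₁₊≡s (suc i))) (sym (a₁₊≡s i)) (falling i k≤i)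

δ : ℕ → Seq
δ k n = if n ≡ᵇ k then 1 else 0

δ-diag : ∀ k → δ k k ≡ 1
δ-diag k = cong (if_then 1 else 0) (≡ᵇ-true k)

δ-off : ∀ {k n} → n ≢ k → δ k n ≡ 0
δ-off n≢k = cong (if_then 1 else 0) (≡ᵇ-false n≢k)

δ+-unimodal-ascending : ∀ ℓ {a : Seq} → Unimodal a → a ℓ < a (suc ℓ) → Unimodal (λ n → δ ℓ n + a n)
δ+-unimodal-ascending ℓ {a} (p , rising , falling) ascent = p , rising′ , falling′
  where
  ℓ<p : ℓ < p
  ℓ<p = ≰⇒> (λ p≤ℓ → <⇒≱ ascent (falling ℓ p≤ℓ))
  rising′ : ∀ i → suc i ≤ p → δ ℓ i + a i ≤ δ ℓ (suc i) + a (suc i)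
  rising′ i i<p with i ≟ ℓ
  ... | yes refl rewrite δ-diag ℓ | δ-off {ℓ} {suc ℓ} 1+n≢n = ascent
  ... | no  i≢ℓ  rewrite δ-off i≢ℓ = m≤n⇒m≤o+n (δ ℓ (suc i)) (rising i i<p)
  falling′ : ∀ i → p ≤ i → δ ℓ (suc i) + a (suc i) ≤ δ ℓ i + a i
  falling′ i p≤i
    rewrite δ-off {ℓ} {suc i} (>⇒≢ (<-trans ℓ<p (s≤s p≤i))) | δ-off {ℓ} {i} (>⇒≢ (<-≤-trans ℓ<p p≤i)) =
    falling i p≤i

δ+-unimodal-peaked : ∀ ℓ {a : Seq} → (∀ i → i < ℓ → a i ≡ 0) → (∀ i → ℓ ≤ i → a (suc i) ≤ a i) →
  Unimodal (λ n → δ ℓ n + a n)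
δ+-unimodal-peaked ℓ {a} zero-before falling = ℓ , rising′ , falling′
  where
  rising′ : ∀ i → suc i ≤ ℓ → δ ℓ i + a i ≤ δ ℓ (suc i) + a (suc i)
  rising′ i i<ℓ rewrite δ-off (<⇒≢ i<ℓ) | zero-before i i<ℓ = z≤n
  falling′ : ∀ i → ℓ ≤ i → δ ℓ (suc i) + a (suc i) ≤ δ ℓ i + a i
  falling′ i ℓ≤i rewrite δ-off {ℓ} {suc i} (>⇒≢ (s≤s ℓ≤i)) = m≤n⇒m≤o+n (δ ℓ i) (falling i ℓ≤i)

-- delay j s is x^j s, pastSum j s is (x + ⋯ + x^j) s and window ℓ s is (1 + x + ⋯ + x^ℓ) s.
delay : ℕ → Seq → Seq
delay zero    s n       = s n
delay (suc j) s zero    = 0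
delay (suc j) s (suc n) = delay j s n

pastSum : ℕ → Seq → Seq
pastSum zero    s n       = 0
pastSum (suc j) s zero    = 0
pastSum (suc j) s (suc n) = s n + pastSum j s n

window : ℕ → Seq → Seq
window ℓ s n = pastSum ℓ s n + s n

delay-< : ∀ j s {n} → n < j → delay j s n ≡ 0
delay-< (suc j) s {zero}  _         = refl
delay-< (suc j) s {suc n} (s≤s n<j) = delay-< j s n<j

delay-≥ : ∀ j s {n} → j ≤ n → delay j s n ≡ s (n ∸ j)
delay-≥ zero    s _         = refl
delay-≥ (suc j) s (s≤s j≤n) = delay-≥ j s j≤n

delay-diag : ∀ j s → delay j s j ≡ s 0
delay-diag zero    s = refl
delay-diag (suc j) s = delay-diag j s

pastSum-cong : ∀ j {s t : Seq} → (∀ m → s m ≡ t m) → ∀ n → pastSum j s n ≡ pastSum j t n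
pastSum-cong zero    _   _       = refl
pastSum-cong (suc j) _   zero    = refl
pastSum-cong (suc j) s≗t (suc n) = cong₂ _+_ (s≗t n) (pastSum-cong j s≗t n)

pastSum-vanishes : ∀ j s n → (∀ m → m < n → s m ≡ 0) → pastSum j s n ≡ 0
pastSum-vanishes zero    s n       _         = refl
pastSum-vanishes (suc j) s zero    _         = refl
pastSum-vanishes (suc j) s (suc n) vanishing =
  cong₂ _+_ (vanishing n ≤-refl) (pastSum-vanishes j s n (λ m m<n → vanishing m (m<n⇒m<1+n m<n)))

window-vanishes : ∀ ℓ s n → (∀ m → m ≤ n → s m ≡ 0) → window ℓ s n ≡ 0
window-vanishes ℓ s n vanishing =
  cong₂ _+_ (pastSum-vanishes ℓ s n (λ m m<n → vanishing m (<⇒≤ m<n))) (vanishing n ≤-refl)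

pastSum-step : ∀ j s n → pastSum j s (suc n) + delay j s n ≡ pastSum j s n + s n
pastSum-step zero    s n       = refl
pastSum-step (suc j) s zero    =
  trans (+-identityʳ _) (trans (cong (s 0 +_) (pastSum-vanishes j s 0 (λ _ ()))) (+-identityʳ (s 0)))
pastSum-step (suc j) s (suc n) = begin
  (s (suc n) + pastSum j s (suc n)) + delay j s n ≡⟨ +-assoc (s (suc n)) _ _ ⟩
  s (suc n) + (pastSum j s (suc n) + delay j s n) ≡⟨ cong (s (suc n) +_) (pastSum-step j s n) ⟩
  s (suc n) + (pastSum j s n + s n)                ≡⟨ cong (s (suc n) +_) (+-comm (pastSum j s n) (s n)) ⟩
  s (suc n) + (s n + pastSum j s n)                ≡⟨ +-comm (s (suc n)) _ ⟩
  (s n + pastSum j s n) + s (suc n)                ∎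
  where open ≡-Reasoning

-- (1 − x) (1 + x + ⋯ + x^ℓ) s = (1 − x^{ℓ+1}) s, read off at x^{n+1}.
window-step : ∀ ℓ s n → window ℓ s (suc n) + delay ℓ s n ≡ s (suc n) + window ℓ s n
window-step ℓ s n = begin
  (pastSum ℓ s (suc n) + s (suc n)) + delay ℓ s n ≡⟨ cong (_+ delay ℓ s n) (+-comm (pastSum ℓ s (suc n)) _) ⟩
  (s (suc n) + pastSum ℓ s (suc n)) + delay ℓ s n ≡⟨ +-assoc (s (suc n)) _ _ ⟩
  s (suc n) + (pastSum ℓ s (suc n) + delay ℓ s n) ≡⟨ cong (s (suc n) +_) (pastSum-step ℓ s n) ⟩
  s (suc n) + window ℓ s n                         ∎
  where open ≡-Reasoning

window-nondecreasing : ∀ ℓ s n → delay ℓ s n ≤ s (suc n) → window ℓ s n ≤ window ℓ s (suc n)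
window-nondecreasing ℓ s n d≤s = +-cancelˡ-≤ (s (suc n)) _ _ (begin
  s (suc n) + window ℓ s n             ≡⟨ window-step ℓ s n ⟨
  window ℓ s (suc n) + delay ℓ s n     ≤⟨ +-monoʳ-≤ (window ℓ s (suc n)) d≤s ⟩
  window ℓ s (suc n) + s (suc n)       ≡⟨ +-comm (window ℓ s (suc n)) _ ⟩
  s (suc n) + window ℓ s (suc n)       ∎)
  where open ≤-Reasoning

window-nonincreasing : ∀ ℓ s n → s (suc n) ≤ delay ℓ s n → window ℓ s (suc n) ≤ window ℓ s n
window-nonincreasing ℓ s n s≤d = +-cancelʳ-≤ (delay ℓ s n) _ _ (begin
  window ℓ s (suc n) + delay ℓ s n     ≡⟨ window-step ℓ s n ⟩
  s (suc n) + window ℓ s n             ≤⟨ +-monoˡ-≤ (window ℓ s n) s≤d ⟩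
  delay ℓ s n + window ℓ s n           ≡⟨ +-comm (delay ℓ s n) _ ⟩
  window ℓ s n + delay ℓ s n           ∎)
  where open ≤-Reasoning

module _ (ℓ : ℕ) {s : Seq} (U : Unimodal s) where
  private
    k : ℕ
    k = proj₁ U

  delay-eventually-dominates : ∀ {i} → k + ℓ ≤ i → s (suc i) ≤ delay ℓ s i
  delay-eventually-dominates {i} k+ℓ≤i = subst (s (suc i) ≤_) (sym (delay-≥ ℓ s (m+n≤o⇒n≤o k k+ℓ≤i)))
    (unimodal-≥-after-peak U (m+n≤o⇒m≤o∸n k k+ℓ≤i) (≤-trans (m∸n≤m i ℓ) (n≤1+n i)))

  -- Once s (1 + i) < s (i − ℓ), the peak lies at or before 1 + i, so for j ≥ i the term s (1 + j)
  -- keeps falling while s (j − ℓ) keeps rising; once j − ℓ is past the peak, s (1 + j) ≤ s (j − ℓ)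
  -- holds anyway.
  delay-domination-persists : ∀ {i j} → i ≤ j → s (suc i) < delay ℓ s i → s (suc j) ≤ delay ℓ s j
  delay-domination-persists {i} {j} i≤j overtaken =
    subst (s (suc j) ≤_) (sym (delay-≥ ℓ s (≤-trans ℓ≤i i≤j))) bound
    where
    ℓ≤i : ℓ ≤ i
    ℓ≤i = ≮⇒≥ (λ i<ℓ → n≮0 (subst (s (suc i) <_) (delay-< ℓ s i<ℓ) overtaken))
    overtaken′ : s (suc i) < s (i ∸ ℓ)
    overtaken′ = subst (s (suc i) <_) (delay-≥ ℓ s ℓ≤i) overtaken
    k≤1+i : k ≤ suc i
    k≤1+i = ≮⇒≥ (λ 1+i<k → <⇒≱ overtaken′
              (unimodal-≤-before-peak U (≤-trans (m∸n≤m i ℓ) (n≤1+n i)) (<⇒≤ 1+i<k)))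
    bound : s (suc j) ≤ s (j ∸ ℓ)
    bound with k ≤? j ∸ ℓ
    ... | yes k≤j∸ℓ = unimodal-≥-after-peak U k≤j∸ℓ (≤-trans (m∸n≤m j ℓ) (n≤1+n j))
    ... | no  k≰j∸ℓ = begin
      s (suc j) ≤⟨ unimodal-≥-after-peak U k≤1+i (s≤s i≤j) ⟩
      s (suc i) ≤⟨ <⇒≤ overtaken′ ⟩
      s (i ∸ ℓ) ≤⟨ unimodal-≤-before-peak U (∸-monoˡ-≤ ℓ i≤j) (<⇒≤ (≰⇒> k≰j∸ℓ)) ⟩
      s (j ∸ ℓ) ∎
      where open ≤-Reasoning

  window-unimodal : Unimodal (window ℓ s)
  window-unimodal = unimodal-if-descents-persist (k + ℓ) eventually persist
    where
    eventually : ∀ i → k + ℓ ≤ i → window ℓ s (suc i) ≤ window ℓ s i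
    eventually i k+ℓ≤i = window-nonincreasing ℓ s i (delay-eventually-dominates k+ℓ≤i)
    persist : ∀ i j → i ≤ j → window ℓ s (suc i) < window ℓ s i → window ℓ s (suc j) ≤ window ℓ s j
    persist i j i≤j descent = window-nonincreasing ℓ s j (delay-domination-persists i≤j
      (≰⇒> (λ d≤s → <⇒≱ descent (window-nondecreasing ℓ s i d≤s))))

-- Words and their blocks of ∞'s

∞s : ℕ → Word
∞s g = replicate g nothing

∞s-++-∷ : ∀ g (w : Word) → ∞s g ++ nothing ∷ w ≡ nothing ∷ ∞s g ++ w
∞s-++-∷ zero    w = refl
∞s-++-∷ (suc g) w = cong (nothing ∷_) (∞s-++-∷ g w)

length-∞s-++ : ∀ g (w : Word) → length (∞s g ++ w) ≡ g + length w
length-∞s-++ g w = trans (length-++ (∞s g)) (cong (_+ length w) (length-replicate g))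

drop-replicate : ∀ {A : Set} k g (x : A) → drop k (replicate g x) ≡ replicate (g ∸ k) x
drop-replicate zero    g       x = refl
drop-replicate (suc k) zero    x = refl
drop-replicate (suc k) (suc g) x = drop-replicate k g x

allInf-∞s : ∀ g → allInf (∞s g) ≡ true
allInf-∞s zero    = refl
allInf-∞s (suc g) = allInf-∞s g

allInf-∞s-++-just : ∀ g u w → allInf (∞s g ++ just u ∷ w) ≡ false
allInf-∞s-++-just zero    u w = refl
allInf-∞s-++-just (suc g) u w = allInf-∞s-++-just g u w

allInf-take-∞s-++ : ∀ L w → allInf (take L (∞s L ++ w)) ≡ true
allInf-take-∞s-++ zero    w = refl
allInf-take-∞s-++ (suc L) w = allInf-take-∞s-++ L w

allInf-take-∞s-++-just : ∀ {g L} u w → g < L → allInf (take L (∞s g ++ just u ∷ w)) ≡ false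
allInf-take-∞s-++-just {zero}  {suc L} u w _         = refl
allInf-take-∞s-++-just {suc g} {suc L} u w (s≤s g<L) = allInf-take-∞s-++-just u w g<L

allB-applyUpTo-∘ : ∀ (p : ℕ → Bool) (f g : ℕ → ℕ) n →
  allB p (applyUpTo (f ∘ g) n) ≡ allB (p ∘ f) (applyUpTo g n)
allB-applyUpTo-∘ p f g zero    = refl
allB-applyUpTo-∘ p f g (suc n) = cong (p (f (g 0)) ∧_) (allB-applyUpTo-∘ p f (g ∘ suc) n)

endsWithInfBlock-∷ : ∀ ℓ x w → allInf (x ∷ w) ≡ false → endsWithInfBlock ℓ (x ∷ w) ≡ endsWithInfBlock ℓ w
endsWithInfBlock-∷ ℓ x w notAllInf with ℓ ≤? length w
... | yes ℓ≤n rewrite ≤ᵇ-true ℓ≤n | ≤ᵇ-true (m≤n⇒m≤1+n ℓ≤n) | +-∸-assoc 1 ℓ≤n = refl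
... | no  ℓ≰n with ℓ ≤? suc (length w)
...   | yes ℓ≤1+n rewrite ≤ᵇ-false ℓ≰n | ≤ᵇ-true ℓ≤1+n | m≤n⇒m∸n≡0 (≰⇒> ℓ≰n) = notAllInf
...   | no  ℓ≰1+n rewrite ≤ᵇ-false ℓ≰n | ≤ᵇ-false ℓ≰1+n = refl

ℓ≤ᵇg≡g≡ᵇℓ : ∀ {ℓ g} → g ≤ ℓ → (ℓ ≤ᵇ g) ≡ (g ≡ᵇ ℓ)
ℓ≤ᵇg≡g≡ᵇℓ {ℓ} {g} g≤ℓ with m≤n⇒m<n∨m≡n g≤ℓ
... | inj₁ g<ℓ  = trans (≤ᵇ-false (<⇒≱ g<ℓ)) (sym (≡ᵇ-false (<⇒≢ g<ℓ)))
... | inj₂ refl = trans (≤ᵇ-true (≤-refl {g})) (sym (≡ᵇ-true g))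

endsWithInfBlock-∞s : ∀ {ℓ g} → g ≤ ℓ → endsWithInfBlock ℓ (∞s g) ≡ (g ≡ᵇ ℓ)
endsWithInfBlock-∞s {ℓ} {g} g≤ℓ = begin
  (ℓ ≤ᵇ length (∞s g)) ∧ allInf (drop (length (∞s g) ∸ ℓ) (∞s g))
    ≡⟨ cong₂ _∧_ (cong (ℓ ≤ᵇ_) (length-replicate g)) (allInf-drop-∞s (length (∞s g) ∸ ℓ)) ⟩
  (ℓ ≤ᵇ g) ∧ true ≡⟨ ∧-identityʳ (ℓ ≤ᵇ g) ⟩
  ℓ ≤ᵇ g          ≡⟨ ℓ≤ᵇg≡g≡ᵇℓ g≤ℓ ⟩
  g ≡ᵇ ℓ          ∎
  where
  open ≡-Reasoning
  allInf-drop-∞s : ∀ k → allInf (drop k (∞s g)) ≡ true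
  allInf-drop-∞s k = trans (cong allInf (drop-replicate k g nothing)) (allInf-∞s (g ∸ k))

endsWithInfBlock-∞s-++-just : ∀ ℓ g u w →
  endsWithInfBlock ℓ (∞s g ++ just u ∷ w) ≡ endsWithInfBlock ℓ (just u ∷ w)
endsWithInfBlock-∞s-++-just ℓ zero    u w = refl
endsWithInfBlock-∞s-++-just ℓ (suc g) u w =
  trans (endsWithInfBlock-∷ ℓ nothing _ (allInf-∞s-++-just g u w)) (endsWithInfBlock-∞s-++-just ℓ g u w)

noEarlyInfBlock-∷ : ∀ ℓ x w → noEarlyInfBlock ℓ (x ∷ w) ≡
  (if ℓ ≤ᵇ length w then not (allInf (take ℓ (x ∷ w))) else true) ∧ noEarlyInfBlock ℓ w
noEarlyInfBlock-∷ ℓ x w with ℓ ≤? length w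
... | yes ℓ≤n rewrite ≤ᵇ-true ℓ≤n | +-∸-assoc 1 ℓ≤n =
  cong (not (allInf (take ℓ (x ∷ w))) ∧_)
       (allB-applyUpTo-∘ (λ i → not (allInf (take ℓ (drop i (x ∷ w))))) suc id (length w ∸ ℓ))
... | no  ℓ≰n rewrite ≤ᵇ-false ℓ≰n | m≤n⇒m∸n≡0 (≰⇒> ℓ≰n) | m≤n⇒m∸n≡0 (<⇒≤ (≰⇒> ℓ≰n)) = refl

noEarlyInfBlock-short : ∀ ℓ w → length w ≤ ℓ → noEarlyInfBlock ℓ w ≡ true
noEarlyInfBlock-short ℓ w short =
  cong (λ n → allB (λ i → not (allInf (take ℓ (drop i w)))) (upTo n)) (m≤n⇒m∸n≡0 short)

okFrom-∞s-++ : ∀ v ms g w → okFrom v ms (∞s g ++ w) ≡ okFrom v (drop g ms) w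
okFrom-∞s-++ v ms       zero    w = refl
okFrom-∞s-++ v []       (suc g) w = refl
okFrom-∞s-++ v (m ∷ ms) (suc g) w = okFrom-∞s-++ v ms g w

okFrom-[] : ∀ v ms → okFrom v ms [] ≡ true
okFrom-[] v []      = refl
okFrom-[] v (_ ∷ _) = refl

anchorCond-∞s-++ : ∀ ms g w → anchorCond ms (∞s g ++ w) ≡ anchorCond ms w
anchorCond-∞s-++ ms zero    w = refl
anchorCond-∞s-++ ms (suc g) w = anchorCond-∞s-++ ms g w

geqL-antitone : ∀ y {t t′} → t′ ≤ t → T (geqL y t) → T (geqL y t′)
geqL-antitone nothing  _     _ = _
geqL-antitone (just z) t′≤t h = ≤⇒≤ᵇ (≤-trans t′≤t (≤ᵇ⇒≤ _ z h))

okFrom-antitone : ∀ {u v} a′ a w → v ≤ u → a′ ≤ a →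
  T (okFrom u (replicate a 1) w) → T (okFrom v (replicate a′ 1) w)
okFrom-antitone zero     a       w       _   _           _ = _
okFrom-antitone (suc a′) (suc a) []      _   _           _ = _
okFrom-antitone (suc a′) (suc a) (y ∷ w) v≤u (s≤s a′≤a) h =
  Equivalence.from T-∧ (geqL-antitone y (+-monoˡ-≤ 1 v≤u) (proj₁ h′) , okFrom-antitone a′ a w v≤u a′≤a (proj₂ h′))
  where
  h′ = Equivalence.to T-∧ h

-- Counting

count : {A : Set} → (A → Bool) → List A → ℕ
count p []       = 0
count p (x ∷ xs) = (if p x then 1 else 0) + count p xs

length-filter-T? : ∀ {A : Set} (p : A → Bool) xs → length (filter (λ x → T? (p x)) xs) ≡ count p xs
length-filter-T? p []       = refl
length-filter-T? p (x ∷ xs) with p x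
... | true  = cong suc (length-filter-T? p xs)
... | false = length-filter-T? p xs

count-cong : ∀ {A : Set} {p q : A → Bool} → (∀ x → p x ≡ q x) → ∀ xs → count p xs ≡ count q xs
count-cong p≗q []       = refl
count-cong p≗q (x ∷ xs) = cong₂ (λ b n → (if b then 1 else 0) + n) (p≗q x) (count-cong p≗q xs)

count-false : ∀ {A : Set} (xs : List A) → count (λ _ → false) xs ≡ 0
count-false []       = refl
count-false (x ∷ xs) = count-false xs

count-++ : ∀ {A : Set} (p : A → Bool) xs ys → count p (xs ++ ys) ≡ count p xs + count p ys
count-++ p []       ys = refl
count-++ p (x ∷ xs) ys = trans (cong (_ +_) (count-++ p xs ys)) (sym (+-assoc (if p x then 1 else 0) _ _))

count-map : ∀ {A B : Set} (p : B → Bool) (f : A → B) xs → count p (map f xs) ≡ count (p ∘ f) xs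
count-map p f []       = refl
count-map p f (x ∷ xs) = cong (_ +_) (count-map p f xs)

count-concatMap : ∀ {A B : Set} (p : B → Bool) (f : A → List B) xs →
  count p (concatMap f xs) ≡ sum (map (count p ∘ f) xs)
count-concatMap p f []       = refl
count-concatMap p f (x ∷ xs) = trans (count-++ p (f x) (concatMap f xs)) (cong (_ +_) (count-concatMap p f xs))

sumBelow : (ℕ → ℕ) → ℕ → ℕ
sumBelow f zero    = 0
sumBelow f (suc n) = f 0 + sumBelow (f ∘ suc) n

syntax sumBelow (λ i → e) n = ∑[ i < n ] e

sumBelow-cong : ∀ {f g} → (∀ i → f i ≡ g i) → ∀ n → sumBelow f n ≡ sumBelow g n
sumBelow-cong f≗g zero    = refl
sumBelow-cong f≗g (suc n) = cong₂ _+_ (f≗g 0) (sumBelow-cong (f≗g ∘ suc) n)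

sumBelow-zero : ∀ n → ∑[ i < n ] 0 ≡ 0
sumBelow-zero zero    = refl
sumBelow-zero (suc n) = sumBelow-zero n

sum-map-applyUpTo : ∀ (h f : ℕ → ℕ) n → sum (map h (applyUpTo f n)) ≡ ∑[ i < n ] h (f i)
sum-map-applyUpTo h f zero    = refl
sum-map-applyUpTo h f (suc n) = cong (h (f 0) +_) (sum-map-applyUpTo h (f ∘ suc) n)

-- sumFrom v f m is the sum of f i over v ≤ i < m.
sumFrom : ℕ → (ℕ → ℕ) → ℕ → ℕ
sumFrom v f m = ∑[ i < m ] (if v <ᵇ suc i then f i else 0)

sumFrom-≥ : ∀ {v} f {m} → m ≤ v → sumFrom v f m ≡ 0
sumFrom-≥ f {zero}  _         = refl
sumFrom-≥ f {suc m} (s≤s m≤v) = sumFrom-≥ (f ∘ suc) m≤v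

sumFrom-< : ∀ {v} f {m} → v < m → sumFrom v f m ≡ f v + sumFrom (suc v) f m
sumFrom-< {zero}  f {suc m} _         = refl
sumFrom-< {suc v} f {suc m} (s≤s v<m) = sumFrom-< (f ∘ suc) v<m

-- The hook (h, 1, …, 1) with ℓ = 1 + ℓ′ ones

module Hook (ℓ′ : ℕ) where
  ℓ : ℕ
  ℓ = suc ℓ′

  δ+window-unimodal : ∀ {s} → Unimodal s → (∀ n → n < ℓ → s n ≡ 0) →
    1 ≤ s (suc ℓ) ⊎ (∀ n → ℓ ≤ n → s (suc n) ≡ 0) → Unimodal (λ n → δ ℓ n + window ℓ s n)
  δ+window-unimodal {s} U zero-before (inj₁ 1≤s₁₊ℓ) = δ+-unimodal-ascending ℓ (window-unimodal ℓ U) ascent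
    where
    ascent : window ℓ s ℓ < window ℓ s (suc ℓ)
    ascent = +-cancelʳ-≤ (delay ℓ s ℓ) _ _ (begin
      suc (window ℓ s ℓ) + delay ℓ s ℓ     ≡⟨ cong (suc (window ℓ s ℓ) +_) (trans (delay-diag ℓ s) (zero-before 0 z<s)) ⟩
      suc (window ℓ s ℓ) + 0               ≡⟨ +-identityʳ _ ⟩
      1 + window ℓ s ℓ                     ≤⟨ +-monoˡ-≤ (window ℓ s ℓ) 1≤s₁₊ℓ ⟩
      s (suc ℓ) + window ℓ s ℓ             ≡⟨ window-step ℓ s ℓ ⟨
      window ℓ s (suc ℓ) + delay ℓ s ℓ     ∎)
      where open ≤-Reasoning
  δ+window-unimodal {s} U zero-before (inj₂ zero-after) = δ+-unimodal-peaked ℓ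
    (λ i i<ℓ → window-vanishes ℓ s i (λ m m≤i → zero-before m (≤-<-trans m≤i i<ℓ)))
    (λ i ℓ≤i → window-nonincreasing ℓ s i (subst (_≤ delay ℓ s i) (sym (zero-after i ℓ≤i)) z≤n))

  F : ℕ → Seq
  F zero    n = 0
  F (suc k) n = δ ℓ n + window ℓ (F k) n

  F-vanishes-below : ∀ k n → n < ℓ → F k n ≡ 0
  F-vanishes-below zero    n _   = refl
  F-vanishes-below (suc k) n n<ℓ = cong₂ _+_ (δ-off (<⇒≢ n<ℓ))
    (window-vanishes ℓ (F k) n (λ m m≤n → F-vanishes-below k m (≤-<-trans m≤n n<ℓ)))

  1≤F-at-ℓ : ∀ k → 1 ≤ F (suc k) ℓ
  1≤F-at-ℓ k = ≤-trans (≤-reflexive (sym (δ-diag ℓ))) (m≤m+n (δ ℓ ℓ) _)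

  F-rises-at-1+ℓ-or-vanishes-past-ℓ : ∀ k → 1 ≤ F k (suc ℓ) ⊎ (∀ n → ℓ ≤ n → F k (suc n) ≡ 0)
  F-rises-at-1+ℓ-or-vanishes-past-ℓ zero          = inj₂ (λ _ _ → refl)
  F-rises-at-1+ℓ-or-vanishes-past-ℓ (suc zero)    = inj₂ (λ n ℓ≤n →
    cong₂ _+_ (δ-off (>⇒≢ (s≤s ℓ≤n))) (window-vanishes ℓ (F 0) (suc n) (λ _ _ → refl)))
  F-rises-at-1+ℓ-or-vanishes-past-ℓ (suc (suc k)) = inj₁ (≤-trans (1≤F-at-ℓ k)
    (m≤n⇒m≤o+n (δ ℓ (suc ℓ)) (≤-trans (m≤m+n (F (suc k) ℓ) _) (m≤m+n _ (F (suc k) (suc ℓ))))))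

  F-unimodal : ∀ k → Unimodal (F k)
  F-unimodal zero    = 0 , (λ _ ()) , (λ _ _ → z≤n)
  F-unimodal (suc k) =
    δ+window-unimodal (F-unimodal k) (F-vanishes-below k) (F-rises-at-1+ℓ-or-vanishes-past-ℓ k)

  ones : List ℕ
  ones = replicate ℓ 1

  -- Tail v g w: w completes a fault-free word whose last integer letter v is followed by g ∞'s.
  Tail : ℕ → ℕ → Word → Bool
  Tail v g []            = g ≡ᵇ ℓ
  Tail v g (nothing ∷ w) = (g <ᵇ ℓ) ∧ Tail v (suc g) w
  Tail v g (just u ∷ w)  = (g <ᵇ ℓ) ∧ ((v <ᵇ u) ∧ Tail u 0 w)

  hookFaultFree : Word → Bool
  hookFaultFree []                = false
  hookFaultFree (nothing ∷ [])    = true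
  hookFaultFree (nothing ∷ _ ∷ _) = false
  hookFaultFree (just v ∷ w)      = Tail v 0 w

  Valid : Word → Bool
  Valid w = (anchorCond ones w ∧ endsWithInfBlock ℓ w) ∧ noEarlyInfBlock ℓ w

  noEarly-just-∷ : ∀ v w → noEarlyInfBlock ℓ (just v ∷ w) ≡ noEarlyInfBlock ℓ w
  noEarly-just-∷ v w =
    trans (noEarlyInfBlock-∷ ℓ (just v) w) (cong (_∧ noEarlyInfBlock ℓ w) (if-true-true (ℓ ≤ᵇ length w)))

  noEarly-∞s-++-just : ∀ {g} u w → g < ℓ →
    noEarlyInfBlock ℓ (∞s g ++ just u ∷ w) ≡ noEarlyInfBlock ℓ (just u ∷ w)
  noEarly-∞s-++-just {zero}  u w _   = refl
  noEarly-∞s-++-just {suc g} u w g<ℓ = begin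
    noEarlyInfBlock ℓ (nothing ∷ X)
      ≡⟨ noEarlyInfBlock-∷ ℓ nothing X ⟩
    (if ℓ ≤ᵇ length X then not (allInf (take ℓ (nothing ∷ X))) else true) ∧ noEarlyInfBlock ℓ X
      ≡⟨ cong (λ b → (if ℓ ≤ᵇ length X then not b else true) ∧ noEarlyInfBlock ℓ X)
              (allInf-take-∞s-++-just u w g<ℓ) ⟩
    (if ℓ ≤ᵇ length X then true else true) ∧ noEarlyInfBlock ℓ X
      ≡⟨ cong (_∧ noEarlyInfBlock ℓ X) (if-true-true (ℓ ≤ᵇ length X)) ⟩
    noEarlyInfBlock ℓ X
      ≡⟨ noEarly-∞s-++-just u w (<-trans (n<1+n g) g<ℓ) ⟩
    noEarlyInfBlock ℓ (just u ∷ w) ∎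
    where
    open ≡-Reasoning
    X = ∞s g ++ just u ∷ w

  noEarly-∞s-full : ∀ x w → noEarlyInfBlock ℓ (∞s ℓ ++ x ∷ w) ≡ false
  noEarly-∞s-full x w = begin
    noEarlyInfBlock ℓ (nothing ∷ X)
      ≡⟨ noEarlyInfBlock-∷ ℓ nothing X ⟩
    (if ℓ ≤ᵇ length X then not (allInf (take ℓ (∞s ℓ ++ x ∷ w))) else true) ∧ noEarlyInfBlock ℓ X
      ≡⟨ cong₂ (λ c b → (if c then not b else true) ∧ noEarlyInfBlock ℓ X)
               (≤ᵇ-true long) (allInf-take-∞s-++ ℓ (x ∷ w)) ⟩
    false ∎
    where
    open ≡-Reasoning
    X = ∞s ℓ′ ++ x ∷ w
    long : ℓ ≤ length X
    long = subst (ℓ ≤_) (sym (length-∞s-++ ℓ′ (x ∷ w))) (m<m+n ℓ′ z<s)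

  -- Every constraint of v past u is implied by v < u and the constraints of u.
  anchorCond-step : ∀ v u w {g} → g < ℓ →
    anchorCond ones (just v ∷ ∞s g ++ just u ∷ w) ≡ (v <ᵇ u) ∧ anchorCond ones (just u ∷ w)
  anchorCond-step v u w {g} (s≤s g≤ℓ′) = begin
    okFrom v ones (∞s g ++ just u ∷ w) ∧ anchorCond ones (∞s g ++ just u ∷ w)
      ≡⟨ cong₂ _∧_ (trans (okFrom-∞s-++ v ones g _) (cong (λ ms → okFrom v ms (just u ∷ w)) drop-ones))
                   (anchorCond-∞s-++ ones g _) ⟩
    ((v + 1 ≤ᵇ u) ∧ okFrom v (replicate (ℓ′ ∸ g) 1) w) ∧ (okFrom u ones w ∧ anchorCond ones w)
      ≡⟨ ∧-redundant (v + 1 ≤ᵇ u) _ _ implied ⟩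
    (v + 1 ≤ᵇ u) ∧ anchorCond ones (just u ∷ w)
      ≡⟨ cong (λ m → (m ≤ᵇ u) ∧ anchorCond ones (just u ∷ w)) (+-comm v 1) ⟩
    (v <ᵇ u) ∧ anchorCond ones (just u ∷ w) ∎
    where
    open ≡-Reasoning
    drop-ones : drop g ones ≡ 1 ∷ replicate (ℓ′ ∸ g) 1
    drop-ones = trans (drop-replicate g ℓ 1) (cong (λ n → replicate n 1) (+-∸-assoc 1 g≤ℓ′))
    implied : T (v + 1 ≤ᵇ u) → T (okFrom u ones w ∧ anchorCond ones w) →
              T (okFrom v (replicate (ℓ′ ∸ g) 1) w)
    implied v<u h = okFrom-antitone (ℓ′ ∸ g) ℓ w (≤-trans (m≤m+n v 1) (≤ᵇ⇒≤ (v + 1) u v<u))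
      (≤-trans (m∸n≤m ℓ′ g) (n≤1+n ℓ′)) (proj₁ (Equivalence.to T-∧ h))

  Valid-end : ∀ v {g} → g ≤ ℓ → Valid (just v ∷ ∞s g ++ []) ≡ (g ≡ᵇ ℓ)
  Valid-end v {g} g≤ℓ = begin
    Valid (just v ∷ ∞s g ++ [])
      ≡⟨ cong₂ _∧_ (cong₂ _∧_ (cong₂ _∧_ okFrom≡ (anchorCond-∞s-++ ones g [])) ends≡) noEarly≡ ⟩
    ((true ∧ true) ∧ (g ≡ᵇ ℓ)) ∧ true
      ≡⟨ ∧-identityʳ (g ≡ᵇ ℓ) ⟩
    g ≡ᵇ ℓ ∎
    where
    open ≡-Reasoning
    okFrom≡ : okFrom v ones (∞s g ++ []) ≡ true
    okFrom≡ = trans (okFrom-∞s-++ v ones g []) (okFrom-[] v (drop g ones))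
    ends≡ : endsWithInfBlock ℓ (just v ∷ ∞s g ++ []) ≡ (g ≡ᵇ ℓ)
    ends≡ = trans (endsWithInfBlock-∷ ℓ (just v) _ refl)
                  (trans (cong (endsWithInfBlock ℓ) (++-identityʳ (∞s g))) (endsWithInfBlock-∞s g≤ℓ))
    noEarly≡ : noEarlyInfBlock ℓ (just v ∷ ∞s g ++ []) ≡ true
    noEarly≡ = trans (noEarly-just-∷ v _) (noEarlyInfBlock-short ℓ (∞s g ++ []) (subst (_≤ ℓ) (sym short) g≤ℓ))
      where short = trans (length-∞s-++ g []) (+-identityʳ g)

  Valid-overlong : ∀ v x w → Valid (just v ∷ ∞s ℓ ++ x ∷ w) ≡ false
  Valid-overlong v x w =
    trans (cong ((anchorCond ones X ∧ endsWithInfBlock ℓ X) ∧_)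
                (trans (noEarly-just-∷ v _) (noEarly-∞s-full x w)))
          (∧-zeroʳ _)
    where X = just v ∷ ∞s ℓ ++ x ∷ w

  Valid-next : ∀ v u w {g} → g < ℓ →
    Valid (just v ∷ ∞s g ++ just u ∷ w) ≡ (v <ᵇ u) ∧ Valid (just u ∷ w)
  Valid-next v u w {g} g<ℓ = begin
    Valid (just v ∷ X)
      ≡⟨ cong₂ _∧_ (cong₂ _∧_ (anchorCond-step v u w g<ℓ) ends≡) noEarly≡ ⟩
    (((v <ᵇ u) ∧ A) ∧ E) ∧ N
      ≡⟨ cong (_∧ N) (∧-assoc (v <ᵇ u) A E) ⟩
    ((v <ᵇ u) ∧ (A ∧ E)) ∧ N
      ≡⟨ ∧-assoc (v <ᵇ u) (A ∧ E) N ⟩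
    (v <ᵇ u) ∧ Valid (just u ∷ w) ∎
    where
    open ≡-Reasoning
    X = ∞s g ++ just u ∷ w
    A = anchorCond ones (just u ∷ w)
    E = endsWithInfBlock ℓ (just u ∷ w)
    N = noEarlyInfBlock ℓ (just u ∷ w)
    ends≡ : endsWithInfBlock ℓ (just v ∷ X) ≡ E
    ends≡ = trans (endsWithInfBlock-∷ ℓ (just v) X refl) (endsWithInfBlock-∞s-++-just ℓ g u w)
    noEarly≡ : noEarlyInfBlock ℓ (just v ∷ X) ≡ N
    noEarly≡ = trans (noEarly-just-∷ v X) (noEarly-∞s-++-just u w g<ℓ)

  Tail-overlong : ∀ v x w → Tail v ℓ (x ∷ w) ≡ false
  Tail-overlong v nothing  w = cong (_∧ Tail v (suc ℓ) w) (<ᵇ-false (n≮n ℓ))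
  Tail-overlong v (just u) w = cong (_∧ ((v <ᵇ u) ∧ Tail u 0 w)) (<ᵇ-false (n≮n ℓ))

  Valid≡Tail : ∀ w v {g} → g ≤ ℓ → Valid (just v ∷ ∞s g ++ w) ≡ Tail v g w
  Valid≡Tail []      v g≤ℓ = Valid-end v g≤ℓ
  Valid≡Tail (x ∷ w) v g≤ℓ with m≤n⇒m<n∨m≡n g≤ℓ
  ... | inj₂ refl = trans (Valid-overlong v x w) (sym (Tail-overlong v x w))
  Valid≡Tail (nothing ∷ w) v {g} _ | inj₁ g<ℓ = begin
    Valid (just v ∷ ∞s g ++ nothing ∷ w) ≡⟨ cong (λ y → Valid (just v ∷ y)) (∞s-++-∷ g w) ⟩
    Valid (just v ∷ ∞s (suc g) ++ w)     ≡⟨ Valid≡Tail w v g<ℓ ⟩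
    Tail v (suc g) w                     ≡⟨ cong (_∧ Tail v (suc g) w) (<ᵇ-true g<ℓ) ⟨
    Tail v g (nothing ∷ w)               ∎
    where open ≡-Reasoning
  Valid≡Tail (just u ∷ w)  v {g} _ | inj₁ g<ℓ = begin
    Valid (just v ∷ ∞s g ++ just u ∷ w) ≡⟨ Valid-next v u w g<ℓ ⟩
    (v <ᵇ u) ∧ Valid (just u ∷ w)       ≡⟨ cong ((v <ᵇ u) ∧_) (Valid≡Tail w u z≤n) ⟩
    (v <ᵇ u) ∧ Tail u 0 w               ≡⟨ cong (_∧ ((v <ᵇ u) ∧ Tail u 0 w)) (<ᵇ-true g<ℓ) ⟨
    Tail v g (just u ∷ w)               ∎
    where open ≡-Reasoning

  -- ℓOf (hook h ℓ) is length ones, which equals ℓ only propositionally.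
  isFaultFree-hook : ∀ h w → isFaultFree (hook h ℓ) w ≡ hookFaultFree w
  isFaultFree-hook h = go (length-replicate ℓ)
    where
    go : ∀ {L} → L ≡ ℓ → ∀ w →
      isSingleInf w ∨ ((anchorCond ones w ∧ endsWithInfBlock L w) ∧ (startsWithInt w ∧ noEarlyInfBlock L w))
        ≡ hookFaultFree w
    go refl []                = ∧-zeroʳ (endsWithInfBlock ℓ [])
    go refl (nothing ∷ [])    = refl
    go refl (nothing ∷ _ ∷ _) = ∧-zeroʳ _
    go refl (just v ∷ w)      = Valid≡Tail w v z≤n

  module Counting (d : ℕ) where
    countWords : (Word → Bool) → Seq
    countWords p n = count p (words d n)

    countWords-suc : ∀ p n → countWords p (suc n) ≡
      countWords (p ∘ (nothing ∷_)) n + ∑[ i < d ] countWords (p ∘ (just (suc i) ∷_)) n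
    countWords-suc p n = begin
      count p (concatMap prefix (letters d))
        ≡⟨ count-concatMap p prefix (letters d) ⟩
      count p (prefix nothing) + sum (map (count p ∘ prefix) (map (λ i → just (suc i)) (upTo d)))
        ≡⟨ cong₂ _+_ (count-map p (nothing ∷_) (words d n)) (cong sum (sym (map-∘ (upTo d)))) ⟩
      countWords (p ∘ (nothing ∷_)) n + sum (map (λ i → count p (prefix (just (suc i)))) (upTo d))
        ≡⟨ cong (countWords (p ∘ (nothing ∷_)) n +_)
                (sum-map-applyUpTo (λ i → count p (prefix (just (suc i)))) id d) ⟩
      countWords (p ∘ (nothing ∷_)) n + ∑[ i < d ] count p (prefix (just (suc i)))
        ≡⟨ cong (countWords (p ∘ (nothing ∷_)) n +_)
                (sumBelow-cong (λ i → count-map p (just (suc i) ∷_) (words d n)) d) ⟩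
      countWords (p ∘ (nothing ∷_)) n + ∑[ i < d ] countWords (p ∘ (just (suc i) ∷_)) n ∎
      where
      open ≡-Reasoning
      prefix : Letter → List Word
      prefix a = map (a ∷_) (words d n)

    countWords-∧ : ∀ b p n → countWords (λ w → b ∧ p w) n ≡ (if b then countWords p n else 0)
    countWords-∧ true  p n = refl
    countWords-∧ false p n = count-false (words d n)

    tails : ℕ → ℕ → Seq
    tails v g = countWords (Tail v g)

    -- startsAbove v n is the sum of tails u 0 n over v < u ≤ d.
    startsAbove : ℕ → Seq
    startsAbove v n = sumFrom v (λ i → tails (suc i) 0 n) d

    tails-suc : ∀ v g n → tails v g (suc n) ≡ (if g <ᵇ ℓ then tails v (suc g) n + startsAbove v n else 0)
    tails-suc v g n = trans (countWords-suc (Tail v g) n) (split (g <ᵇ ℓ))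
      where
      split : ∀ b →
        countWords (λ w → b ∧ Tail v (suc g) w) n
          + ∑[ i < d ] countWords (λ w → b ∧ ((v <ᵇ suc i) ∧ Tail (suc i) 0 w)) n
          ≡ (if b then tails v (suc g) n + startsAbove v n else 0)
      split true  =
        cong (tails v (suc g) n +_) (sumBelow-cong (λ i → countWords-∧ (v <ᵇ suc i) (Tail (suc i) 0) n) d)
      split false = cong₂ _+_ (count-false (words d n))
                              (trans (sumBelow-cong (λ _ → count-false (words d n)) d) (sumBelow-zero d))

    tails-full : ∀ v n → tails v ℓ n ≡ δ 0 n
    tails-full v zero    = cong (λ b → (if b then 1 else 0) + 0) (≡ᵇ-true ℓ)
    tails-full v (suc n) =
      trans (tails-suc v ℓ n) (cong (if_then tails v (suc ℓ) n + startsAbove v n else 0) (<ᵇ-false (n≮n ℓ)))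

    tails≡δ+pastSum : ∀ k {g} v → g + k ≡ ℓ → ∀ n → tails v g n ≡ δ k n + pastSum k (startsAbove v) n
    tails≡δ+pastSum zero    {g} v g+0≡ℓ n with trans (sym (+-identityʳ g)) g+0≡ℓ
    ... | refl = trans (tails-full v n) (sym (+-identityʳ (δ 0 n)))
    tails≡δ+pastSum (suc k) {g} v g+1+k≡ℓ zero    =
      cong (λ b → (if b then 1 else 0) + 0) (≡ᵇ-false (<⇒≢ g<ℓ))
      where g<ℓ = subst (g <_) g+1+k≡ℓ (m<m+n g z<s)
    tails≡δ+pastSum (suc k) {g} v g+1+k≡ℓ (suc n) = begin
      tails v g (suc n)
        ≡⟨ tails-suc v g n ⟩
      (if g <ᵇ ℓ then tails v (suc g) n + R n else 0)
        ≡⟨ cong (if_then tails v (suc g) n + R n else 0) (<ᵇ-true g<ℓ) ⟩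
      tails v (suc g) n + R n
        ≡⟨ cong (_+ R n) (tails≡δ+pastSum k v (trans (sym (+-suc g k)) g+1+k≡ℓ) n) ⟩
      (δ k n + pastSum k R n) + R n
        ≡⟨ +-assoc (δ k n) _ (R n) ⟩
      δ k n + (pastSum k R n + R n)
        ≡⟨ cong (δ k n +_) (+-comm (pastSum k R n) (R n)) ⟩
      δ k n + (R n + pastSum k R n) ∎
      where
      open ≡-Reasoning
      R = startsAbove v
      g<ℓ = subst (g <_) g+1+k≡ℓ (m<m+n g z<s)

    startsAbove≡F : ∀ k v → v + k ≡ d → ∀ n → startsAbove v n ≡ F k n
    startsAbove≡F zero    v v+0≡d n = sumFrom-≥ _ (≤-reflexive (trans (sym v+0≡d) (+-identityʳ v)))
    startsAbove≡F (suc k) v v+1+k≡d n = begin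
      startsAbove v n
        ≡⟨ sumFrom-< _ (subst (v <_) v+1+k≡d (m<m+n v z<s)) ⟩
      tails (suc v) 0 n + startsAbove (suc v) n
        ≡⟨ cong₂ _+_ (tails≡δ+pastSum ℓ (suc v) refl n) (startsAbove≡F k (suc v) v+1+k≡d′ n) ⟩
      (δ ℓ n + pastSum ℓ (startsAbove (suc v)) n) + F k n
        ≡⟨ cong (λ m → (δ ℓ n + m) + F k n) (pastSum-cong ℓ (startsAbove≡F k (suc v) v+1+k≡d′) n) ⟩
      (δ ℓ n + pastSum ℓ (F k) n) + F k n
        ≡⟨ +-assoc (δ ℓ n) _ (F k n) ⟩
      F (suc k) n ∎
      where
      open ≡-Reasoning
      v+1+k≡d′ : suc v + k ≡ d
      v+1+k≡d′ = trans (sym (+-suc v k)) v+1+k≡d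

    Bcoeff-hook : ∀ h n → Bcoeff (hook h ℓ) d n ≡ countWords hookFaultFree n
    Bcoeff-hook h n =
      trans (length-filter-T? (isFaultFree (hook h ℓ)) (words d n)) (count-cong (isFaultFree-hook h) (words d n))

    countWords-∞-first : ∀ n → countWords (hookFaultFree ∘ (nothing ∷_)) n ≡ δ 0 n
    countWords-∞-first zero    = refl
    countWords-∞-first (suc n) = trans (countWords-suc _ n)
      (cong₂ _+_ (count-false (words d n)) (trans (sumBelow-cong (λ _ → count-false (words d n)) d) (sumBelow-zero d)))

    BminusX-hook-zero : ∀ h → BminusXcoeff (hook h ℓ) d 0 ≡ 0
    BminusX-hook-zero h = Bcoeff-hook h 0

    BminusX-hook-suc : ∀ h n → BminusXcoeff (hook h ℓ) d (suc n) ≡ F d n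
    BminusX-hook-suc h n = begin
      Bcoeff (hook h ℓ) d (suc n) ∸ δ 0 n
        ≡⟨ cong (_∸ δ 0 n) (trans (Bcoeff-hook h (suc n)) (countWords-suc hookFaultFree n)) ⟩
      (countWords (hookFaultFree ∘ (nothing ∷_)) n + startsAbove 0 n) ∸ δ 0 n
        ≡⟨ cong (λ c → (c + startsAbove 0 n) ∸ δ 0 n) (countWords-∞-first n) ⟩
      (δ 0 n + startsAbove 0 n) ∸ δ 0 n
        ≡⟨ m+n∸m≡n (δ 0 n) _ ⟩
      startsAbove 0 n
        ≡⟨ startsAbove≡F d 0 refl n ⟩
      F d n ∎
      where open ≡-Reasoning

  BminusX-hook-unimodal : ∀ h d → Unimodal (BminusXcoeff (hook h ℓ) d)
  BminusX-hook-unimodal h d = unimodal-shift (BminusX-hook-zero h) (BminusX-hook-suc h) (F-unimodal d)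
    where open Counting d

-- μ₀ = h never enters the anchor condition.
theorem4p23 : (ℓ h d : ℕ) → 1 ≤ ℓ → 1 ≤ h → 1 ≤ d → d ≤ h →
    Unimodal (BminusXcoeff (hook h ℓ) d) × NoInternalZeros (BminusXcoeff (hook h ℓ) d)
theorem4p23 zero     _ _ ()  _ _ _
theorem4p23 (suc ℓ′) h d _ _ _ _ = unimodal , unimodal⇒noInternalZeros unimodal
  where unimodal = Hook.BminusX-hook-unimodal ℓ′ h d
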